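{- Let $G=G_1\vee G_2$ where $G_i$ has $n_i$ vertices and maximum degree $\Delta_i$ ($i=1,2$). If $\Delta_1+n_2\neq \Delta_2+n_1$, then $vs_{\Delta}(G)=1$.
   Context: All graphs are finite and simple. The join $G_1\vee G_2$ has vertex set $V(G_1)\cup V(G_2)$ and edge set $E(G_1)\cup E(G_2)\cup\{uv: u\in V(G_1), v\in V(G_2)\}$; its maximum degree is $\max\{n_1+\Delta_2, n_2+\Delta_1\}$. For a graph invariant $\rho$, the $\rho$-vertex stability number $vs_{\rho}(G)$ is the minimum number of vertices of $G$ whose removal results in a graph $H\subseteq G$ with $\rho(H)\neq\rho(G)$ or with $E(H)=\emptyset$; here $\rho=\Delta$, the maximum degree. -}

module Defs where

open import Data.Nat using (ℕ; zero; suc; _+_; _⊔_)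
open import Data.Bool using (Bool; true; false; not; _∧_; if_then_else_)
open import Data.Fin using (Fin; zero; suc; splitAt)
open import Data.Sum using (_⊎_; inj₁; inj₂)
open import Data.Vec using (lookup)
open import Data.Fin.Subset using (Subset; ∣_∣; ⊥)
open import Relation.Binary.PropositionalEquality using (_≡_; _≢_; refl)
open import Data.Nat using (_≤_)
open import Data.Product using (Σ; _×_; _,_)

record Graph (n : ℕ) : Set where
  field
    adj    : Fin n → Fin n → Bool
    sym    : ∀ i j → adj i j ≡ adj j i
    irrefl : ∀ i → adj i i ≡ false
open Graph public

count : ∀ {n} → (Fin n → Bool) → ℕ
count {zero}  f = 0
count {suc n} f = (if f zero then 1 else 0) + count (λ i → f (suc i))

maxF : ∀ {n} → (Fin n → ℕ) → ℕ
maxF {zero}  f = 0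
maxF {suc n} f = f zero ⊔ maxF (λ i → f (suc i))

kept : ∀ {n} → Subset n → Fin n → Bool
kept S u = not (lookup S u)

deg : ∀ {n} → Graph n → Fin n → ℕ
deg G v = count (adj G v)

Δ : ∀ {n} → Graph n → ℕ
Δ G = maxF (deg G)

degDel : ∀ {n} → Graph n → Subset n → Fin n → ℕ
degDel G S v = count (λ u → kept S u ∧ adj G v u)

ΔDel : ∀ {n} → Graph n → Subset n → ℕ
ΔDel G S = maxF (λ v → if kept S v then degDel G S v else 0)

EdgelessDel : ∀ {n} → Graph n → Subset n → Set
EdgelessDel G S = ∀ u v → kept S u ≡ true → kept S v ≡ true → adj G u v ≡ false

DestabΔ : ∀ {n} → Graph n → Subset n → Set
DestabΔ G S = ΔDel G S ≢ Δ G ⊎ EdgelessDel G S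

VsΔ : ∀ {n} → Graph n → ℕ → Set
VsΔ G k = (Σ (Subset _) λ S → ∣ S ∣ ≡ k × DestabΔ G S)
        × (∀ S → DestabΔ G S → k ≤ ∣ S ∣)

-- The join G₁ ∨ G₂ on Fin (n₁ + n₂): first n₁ vertices from G₁, rest from G₂.
joinAdj : ∀ {n₁ n₂} → Graph n₁ → Graph n₂ → Fin n₁ ⊎ Fin n₂ → Fin n₁ ⊎ Fin n₂ → Bool
joinAdj G₁ G₂ (inj₁ a) (inj₁ b) = adj G₁ a b
joinAdj G₁ G₂ (inj₁ a) (inj₂ b) = true
joinAdj G₁ G₂ (inj₂ a) (inj₁ b) = true
joinAdj G₁ G₂ (inj₂ a) (inj₂ b) = adj G₂ a b

joinAdj-sym : ∀ {n₁ n₂} (G₁ : Graph n₁) (G₂ : Graph n₂) x y → joinAdj G₁ G₂ x y ≡ joinAdj G₁ G₂ y x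
joinAdj-sym G₁ G₂ (inj₁ a) (inj₁ b) = sym G₁ a b
joinAdj-sym G₁ G₂ (inj₁ a) (inj₂ b) = refl
joinAdj-sym G₁ G₂ (inj₂ a) (inj₁ b) = refl
joinAdj-sym G₁ G₂ (inj₂ a) (inj₂ b) = sym G₂ a b

joinAdj-irr : ∀ {n₁ n₂} (G₁ : Graph n₁) (G₂ : Graph n₂) x → joinAdj G₁ G₂ x x ≡ false
joinAdj-irr G₁ G₂ (inj₁ a) = irrefl G₁ a
joinAdj-irr G₁ G₂ (inj₂ a) = irrefl G₂ a

_∨G_ : ∀ {n₁ n₂} → Graph n₁ → Graph n₂ → Graph (n₁ + n₂)
_∨G_ {n₁} G₁ G₂ = record
  { adj    = λ i j → joinAdj G₁ G₂ (splitAt n₁ i) (splitAt n₁ j)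
  ; sym    = λ i j → joinAdj-sym G₁ G₂ (splitAt n₁ i) (splitAt n₁ j)
  ; irrefl = λ i → joinAdj-irr G₁ G₂ (splitAt n₁ i)
  }

module Submission where

-- Write n₁ = |V(G₁)|, n₂ = |V(G₂)| and J = G₁ ∨ G₂.  A vertex of G₁
-- has degree deg_{G₁} + n₂ in J and a vertex of G₂ has degree n₁ + deg_{G₂},
-- so Δ(J) ≥ Δ₁ + n₂ and Δ(J) ≥ Δ₂ + n₁.  Suppose Δ₂ + n₁ < Δ₁ + n₂ and delete
-- one vertex w of G₂.  Every vertex of G₁ is adjacent to w, so its degree drops
-- to at most Δ₁ + n₂ - 1, while every vertex of G₂ already had degree at most
-- Δ₂ + n₁ ≤ Δ₁ + n₂ - 1.  Hence Δ(J - w) < Δ(J); the other inequality is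
-- symmetric (delete a vertex of G₁).  Conversely no set of size 0 is
-- destabilising, because J has an edge.

open import Defs
open import Data.Nat using (ℕ; suc; _+_)
open import Relation.Binary.PropositionalEquality using (_≢_)

open import Data.Nat using (zero; _≤_; _<_; z≤n; s≤s; _⊔_)
open import Data.Nat.Properties
open import Data.Bool using (Bool; true; false; _∧_; if_then_else_)
open import Data.Bool.Properties using (not-¬)
open import Data.Fin using (Fin; zero; suc; splitAt; join; _↑ˡ_; _↑ʳ_)
open import Data.Fin.Properties using (splitAt-join; join-splitAt)
open import Data.Fin.Subset using (Subset; ∣_∣; ⁅_⁆)
open import Data.Fin.Subset.Properties using (∣⁅x⁆∣≡1; x∈⁅x⁆)
open import Data.Vec using (_∷_; lookup)
open import Data.Vec.Properties using ([]=⇒lookup)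
open import Data.Sum using (_⊎_; inj₁; inj₂)
open import Data.Product using (Σ; _×_; _,_)
open import Data.Empty using (⊥-elim)
open import Relation.Binary.Definitions using (tri<; tri≈; tri>)
open import Relation.Binary.PropositionalEquality
  using (_≡_; refl; cong; cong₂; trans; subst) renaming (sym to ≡-sym)

bit : Bool → ℕ
bit b = if b then 1 else 0

bit-mono : ∀ a b → (a ≡ true → b ≡ true) → bit a ≤ bit b
bit-mono true  b a⇒b rewrite a⇒b refl = ≤-refl
bit-mono false b a⇒b = z≤n

count-cong : ∀ {n} (f g : Fin n → Bool) → (∀ i → f i ≡ g i) → count f ≡ count g
count-cong {zero}  f g f≡g = refl
count-cong {suc n} f g f≡g rewrite f≡g zero =
  cong (bit (g zero) +_) (count-cong _ _ (λ i → f≡g (suc i)))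

count-mono : ∀ {n} (f g : Fin n → Bool) → (∀ i → f i ≡ true → g i ≡ true) →
             count f ≤ count g
count-mono {zero}  f g f⇒g = z≤n
count-mono {suc n} f g f⇒g =
  +-mono-≤ (bit-mono (f zero) (g zero) (f⇒g zero)) (count-mono _ _ (λ i → f⇒g (suc i)))

count-mono-strict : ∀ {n} (f g : Fin n → Bool) → (∀ i → f i ≡ true → g i ≡ true) →
                    ∀ x → f x ≡ false → g x ≡ true → suc (count f) ≤ count g
count-mono-strict f g f⇒g zero fx gx rewrite fx | gx =
  s≤s (count-mono _ _ (λ i → f⇒g (suc i)))
count-mono-strict f g f⇒g (suc x) fx gx =
  subst (_≤ count g) (+-suc (bit (f zero)) _)
    (+-mono-≤ (bit-mono (f zero) (g zero) (f⇒g zero))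
              (count-mono-strict _ _ (λ i → f⇒g (suc i)) x fx gx))

count-true : ∀ n → count {n} (λ _ → true) ≡ n
count-true zero    = refl
count-true (suc n) = cong suc (count-true n)

count-split : ∀ a b (f : Fin (a + b) → Bool) →
              count f ≡ count (λ i → f (i ↑ˡ b)) + count (λ j → f (a ↑ʳ j))
count-split zero    b f = refl
count-split (suc a) b f rewrite count-split a b (λ i → f (suc i)) =
  ≡-sym (+-assoc (bit (f zero)) _ _)

maxF-ub : ∀ {n} (f : Fin n → ℕ) i → f i ≤ maxF f
maxF-ub f zero    = m≤m⊔n _ _
maxF-ub f (suc i) = ≤-trans (maxF-ub (λ j → f (suc j)) i) (m≤n⊔m _ _)

maxF-lub : ∀ {n} (f : Fin n → ℕ) k → (∀ i → f i ≤ k) → maxF f ≤ k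
maxF-lub {zero}  f k f≤k = z≤n
maxF-lub {suc n} f k f≤k = ⊔-lub (f≤k zero) (maxF-lub _ k (λ i → f≤k (suc i)))

maxF-attained : ∀ {m} (f : Fin (suc m) → ℕ) → Σ (Fin (suc m)) λ i → maxF f ≡ f i
maxF-attained {zero}  f = zero , ⊔-identityʳ (f zero)
maxF-attained {suc m} f with maxF-attained (λ j → f (suc j))
                           | ≤-total (f zero) (maxF (λ j → f (suc j)))
... | i , max≡fi | inj₁ f0≤max = suc i , trans (m≤n⇒m⊔n≡n f0≤max) max≡fi
... | i , max≡fi | inj₂ max≤f0 = zero , m≥n⇒m⊔n≡m max≤f0

maxF-cong : ∀ {n} (f g : Fin n → ℕ) → (∀ i → f i ≡ g i) → maxF f ≡ maxF g
maxF-cong {zero}  f g f≡g = refl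
maxF-cong {suc n} f g f≡g = cong₂ _⊔_ (f≡g zero) (maxF-cong _ _ (λ i → f≡g (suc i)))

∧-elimʳ : ∀ a {b} → (a ∧ b) ≡ true → b ≡ true
∧-elimʳ true b≡true = b≡true

size-0-keeps-all : ∀ {n} (S : Subset n) → ∣ S ∣ ≡ 0 → ∀ u → kept S u ≡ true
size-0-keeps-all (false ∷ S) ∣S∣≡0 zero    = refl
size-0-keeps-all (false ∷ S) ∣S∣≡0 (suc u) = size-0-keeps-all S ∣S∣≡0 u

module _ {n : ℕ} (G : Graph n) where

  ΔDel-size-0 : (S : Subset n) → ∣ S ∣ ≡ 0 → ΔDel G S ≡ Δ G
  ΔDel-size-0 S ∣S∣≡0 = maxF-cong _ _ keptDeg≡deg
    where
    keeps : ∀ u → kept S u ≡ true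
    keeps = size-0-keeps-all S ∣S∣≡0
    keptDeg≡deg : ∀ v → (if kept S v then degDel G S v else 0) ≡ deg G v
    keptDeg≡deg v rewrite keeps v =
      count-cong _ _ (λ u → cong (_∧ adj G v u) (keeps u))

  destab-nonempty : ∀ u v → adj G u v ≡ true → ∀ S → DestabΔ G S → 1 ≤ ∣ S ∣
  destab-nonempty u v uv S destab with ∣ S ∣ in ∣S∣≡0
  ... | suc _ = s≤s z≤n
  ... | zero with destab
  ...   | inj₁ Δ≢ = ⊥-elim (Δ≢ (ΔDel-size-0 S ∣S∣≡0))
  ...   | inj₂ edgeless = ⊥-elim (not-¬ refl (trans (≡-sym uv)
            (edgeless u v (size-0-keeps-all S ∣S∣≡0 u) (size-0-keeps-all S ∣S∣≡0 v))))

  degDel≤deg : ∀ S v → degDel G S v ≤ deg G v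
  degDel≤deg S v = count-mono _ _ (λ u → ∧-elimʳ (kept S u))

  degDel-neighbour : ∀ v w → adj G v w ≡ true → suc (degDel G ⁅ w ⁆ v) ≤ deg G v
  degDel-neighbour v w vw =
    count-mono-strict _ _ (λ u → ∧-elimʳ (kept ⁅ w ⁆ u)) w w-deleted vw
    where
    w-deleted : (kept ⁅ w ⁆ w ∧ adj G v w) ≡ false
    w-deleted rewrite []=⇒lookup (x∈⁅x⁆ w) = refl

  ΔDel-lub : ∀ S k → (∀ v → degDel G S v ≤ k) → ΔDel G S ≤ k
  ΔDel-lub S k deg≤k = maxF-lub _ k (λ v → keptDeg≤k (kept S v) v)
    where
    keptDeg≤k : ∀ b v → (if b then degDel G S v else 0) ≤ k
    keptDeg≤k true  v = deg≤k v
    keptDeg≤k false v = z≤n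

  -- The vertex v has degree at most k, or degree at most k + 1 and is adjacent
  -- to w; so v has degree at most k once w is deleted.
  HubBound : Fin n → ℕ → Fin n → Set
  HubBound w k v = (adj G v w ≡ true × deg G v ≤ suc k) ⊎ deg G v ≤ k

  ΔDel-hub : ∀ w k → (∀ v → HubBound w k v) → ΔDel G ⁅ w ⁆ ≤ k
  ΔDel-hub w k cases = ΔDel-lub ⁅ w ⁆ k bound
    where
    bound : ∀ v → degDel G ⁅ w ⁆ v ≤ k
    bound v with cases v
    ... | inj₁ (vw , deg≤1+k) = ≤-pred (≤-trans (degDel-neighbour v w vw) deg≤1+k)
    ... | inj₂ deg≤k          = ≤-trans (degDel≤deg ⁅ w ⁆ v) deg≤k

  lowers-Δ : ∀ S k → ΔDel G S ≤ k → suc k ≤ Δ G → DestabΔ G S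
  lowers-Δ S k ΔDel≤k 1+k≤Δ = inj₁ λ ΔDel≡Δ →
    <-irrefl refl (≤-trans (s≤s ΔDel≤k) (subst (suc k ≤_) (≡-sym ΔDel≡Δ) 1+k≤Δ))

  vsΔ-singleton : ∀ u v → adj G u v ≡ true → ∀ w → DestabΔ G ⁅ w ⁆ → VsΔ G 1
  vsΔ-singleton u v uv w destab =
    (⁅ w ⁆ , ∣⁅x⁆∣≡1 w , destab) , destab-nonempty u v uv

module Join {m₁ m₂ : ℕ} (G₁ : Graph (suc m₁)) (G₂ : Graph (suc m₂)) where

  n₁ n₂ : ℕ
  n₁ = suc m₁
  n₂ = suc m₂

  J : Graph (n₁ + n₂)
  J = G₁ ∨G G₂

  adj-join : ∀ x y → adj J (join n₁ n₂ x) (join n₁ n₂ y) ≡ joinAdj G₁ G₂ x y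
  adj-join x y rewrite splitAt-join n₁ n₂ x | splitAt-join n₁ n₂ y = refl

  by-side : (P : Fin (n₁ + n₂) → Set) →
            (∀ i → P (i ↑ˡ n₂)) → (∀ j → P (n₁ ↑ʳ j)) → ∀ v → P v
  by-side P left right v = subst P (join-splitAt n₁ n₂ v) (side (splitAt n₁ v))
    where
    side : ∀ x → P (join n₁ n₂ x)
    side (inj₁ i) = left i
    side (inj₂ j) = right j

  deg-join : ∀ x → deg J (join n₁ n₂ x) ≡
             count (λ a → joinAdj G₁ G₂ x (inj₁ a)) + count (λ b → joinAdj G₁ G₂ x (inj₂ b))
  deg-join x = trans (count-split n₁ n₂ (adj J (join n₁ n₂ x)))
    (cong₂ _+_ (count-cong _ _ (λ a → adj-join x (inj₁ a)))
               (count-cong _ _ (λ b → adj-join x (inj₂ b))))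

  deg-left : ∀ i → deg J (i ↑ˡ n₂) ≡ deg G₁ i + n₂
  deg-left i = trans (deg-join (inj₁ i)) (cong (deg G₁ i +_) (count-true n₂))

  deg-right : ∀ j → deg J (n₁ ↑ʳ j) ≡ n₁ + deg G₂ j
  deg-right j = trans (deg-join (inj₂ j)) (cong (_+ deg G₂ j) (count-true n₁))

  Δ-left : Δ G₁ + n₂ ≤ Δ J
  Δ-left with maxF-attained (deg G₁)
  ... | i , Δ₁≡deg = subst (_≤ Δ J) (trans (deg-left i) (cong (_+ n₂) (≡-sym Δ₁≡deg)))
                           (maxF-ub (deg J) (i ↑ˡ n₂))

  Δ-right : Δ G₂ + n₁ ≤ Δ J
  Δ-right with maxF-attained (deg G₂)
  ... | j , Δ₂≡deg = subst (_≤ Δ J) (trans (deg-right j) (trans (+-comm n₁ _)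
                                       (cong (_+ n₁) (≡-sym Δ₂≡deg))))
                           (maxF-ub (deg J) (n₁ ↑ʳ j))

  edge : adj J zero (n₁ ↑ʳ zero) ≡ true
  edge = adj-join (inj₁ zero) (inj₂ zero)

  delete-right : Δ G₂ + n₁ < Δ G₁ + n₂ → DestabΔ J ⁅ n₁ ↑ʳ zero ⁆
  delete-right lt = lowers-Δ J ⁅ n₁ ↑ʳ zero ⁆ k
                      (ΔDel-hub J (n₁ ↑ʳ zero) k (by-side (HubBound J (n₁ ↑ʳ zero) k) left right))
                                   (subst (_≤ Δ J) (+-suc (Δ G₁) m₂) Δ-left)
    where
    open ≤-Reasoning
    k : ℕ
    k = Δ G₁ + m₂
    left : ∀ i → HubBound J (n₁ ↑ʳ zero) k (i ↑ˡ n₂)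
    left i = inj₁ (adj-join (inj₁ i) (inj₂ zero) , (begin
      deg J (i ↑ˡ n₂) ≡⟨ deg-left i ⟩
      deg G₁ i + n₂   ≤⟨ +-monoˡ-≤ n₂ (maxF-ub (deg G₁) i) ⟩
      Δ G₁ + n₂       ≡⟨ +-suc (Δ G₁) m₂ ⟩
      suc k           ∎))
    right : ∀ j → HubBound J (n₁ ↑ʳ zero) k (n₁ ↑ʳ j)
    right j = inj₂ (begin
      deg J (n₁ ↑ʳ j) ≡⟨ deg-right j ⟩
      n₁ + deg G₂ j   ≤⟨ +-monoʳ-≤ n₁ (maxF-ub (deg G₂) j) ⟩
      n₁ + Δ G₂       ≡⟨ +-comm n₁ (Δ G₂) ⟩
      Δ G₂ + n₁       ≤⟨ ≤-pred (subst (Δ G₂ + n₁ <_) (+-suc (Δ G₁) m₂) lt) ⟩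
      k               ∎)

  delete-left : Δ G₁ + n₂ < Δ G₂ + n₁ → DestabΔ J ⁅ zero ⁆
  delete-left lt = lowers-Δ J ⁅ zero ⁆ k
                     (ΔDel-hub J zero k (by-side (HubBound J zero k) left right))
                                  (subst (_≤ Δ J) (+-suc (Δ G₂) m₁) Δ-right)
    where
    open ≤-Reasoning
    k : ℕ
    k = Δ G₂ + m₁
    left : ∀ i → HubBound J zero k (i ↑ˡ n₂)
    left i = inj₂ (begin
      deg J (i ↑ˡ n₂) ≡⟨ deg-left i ⟩
      deg G₁ i + n₂   ≤⟨ +-monoˡ-≤ n₂ (maxF-ub (deg G₁) i) ⟩
      Δ G₁ + n₂       ≤⟨ ≤-pred (subst (Δ G₁ + n₂ <_) (+-suc (Δ G₂) m₁) lt) ⟩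
      k               ∎)
    right : ∀ j → HubBound J zero k (n₁ ↑ʳ j)
    right j = inj₁ (adj-join (inj₂ j) (inj₁ zero) , (begin
      deg J (n₁ ↑ʳ j) ≡⟨ deg-right j ⟩
      n₁ + deg G₂ j   ≤⟨ +-monoʳ-≤ n₁ (maxF-ub (deg G₂) j) ⟩
      n₁ + Δ G₂       ≡⟨ +-comm n₁ (Δ G₂) ⟩
      Δ G₂ + n₁       ≡⟨ +-suc (Δ G₂) m₁ ⟩
      suc k           ∎))

mainTheorem17 : ∀ {m₁ m₂} (G₁ : Graph (suc m₁)) (G₂ : Graph (suc m₂))
    → Δ G₁ + suc m₂ ≢ Δ G₂ + suc m₁
    → VsΔ (G₁ ∨G G₂) 1
mainTheorem17 {m₁} {m₂} G₁ G₂ Δ≢ with <-cmp (Δ G₁ + suc m₂) (Δ G₂ + suc m₁)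
... | tri< lt _ _ = vsΔ-singleton J zero (suc m₁ ↑ʳ zero) edge zero (delete-left lt)
  where open Join G₁ G₂
... | tri≈ _ eq _ = ⊥-elim (Δ≢ eq)
... | tri> _ _ gt = vsΔ-singleton J zero (suc m₁ ↑ʳ zero) edge (suc m₁ ↑ʳ zero) (delete-right gt)
  where open Join G₁ G₂
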